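{- Any parameterized reduction with input instance $(x,k)$ and computable functions $f,g$ can be computed by a $\mathrm{poly}(g(k))$-memory $(\mathrm{poly}(f(k))\cdot\mathrm{poly}(|x|),\,\mathrm{poly}(f(k))\cdot\mathrm{poly}(|x|))$-time TM-TLM.
   Context: Parameterized reduction: let $A,B\subseteq\Sigma^*\times\mathbb{N}$ be parameterized problems. A parameterized reduction from $A$ to $B$ is an algorithm that, given an instance $(x,k)$ of $A$, outputs an instance $(x',k')$ of $B$ such that (1) $(x,k)$ is a yes-instance of $A$ iff $(x',k')$ is a yes-instance of $B$, (2) $k'\le g(k)$ for some computable function $g$, and (3) the running time of the reduction is bounded by $f(k)\cdot\mathrm{poly}(|x|)$ for some computable function $f$. A Turing machine with two-level memory (TM-TLM) with main memory size $M$ has three tapes: a main memory tape consisting of exactly $M$ cells, an unbounded external memory tape, and an address tape for the external memory; a finite set of states, an input alphabet, a tape alphabet with a blank symbol, a transition function $\delta:Q\times\Gamma\to Q\times\Gamma\times\{L,S,R\}$ acting on the main memory tape, an accepting state, and two distinguished sets of states: Read states and Write states. Entering a Read state, the machine writes an address $addr$ on the address tape, and the content of the main memory cell under the head is replaced by the content of the external cell at address $addr$; entering a Write state, it writes $addr$ on the address tape and the external cell at $addr$ receives the content of the main memory cell under the head. After a Read/Write the head may move left, right, or stay; each Read/Write takes one unit of time. The input resides on the external tape. The time of the machine is the number of transitions executed other than Read/Write operations, and the IO time is the number of Read/Write operations. An $M$-memory $(T,IO)$-time TM-TLM has main memory size $M$, time $O(T)$ and IO time $O(IO)$. -}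

module Defs where

open import Data.Nat using (ℕ; zero; suc; _+_; _*_; _<ᵇ_; _≡ᵇ_; _<_)
open import Data.Fin using (Fin; fromℕ<)
open import Data.Bool using (Bool; true; false; if_then_else_)
open import Data.List using (List; []; _∷_; map; _++_; replicate; length; lookup)
open import Data.Product using (_×_; _,_)
open import Relation.Binary.PropositionalEquality using (_≡_)

-- Alphabets and encodings of instances (x , k) ∈ Σ* × ℕ, Σ = Bool.
-- Tape alphabet Γ m = Fin (4 + m): 0 = blank, 1 = bit 0, 2 = bit 1,
-- 3 = separator, the remaining m symbols are auxiliary.

Γ : ℕ → Set
Γ m = Fin (4 + m)

blank bit0 bit1 sep : ∀ {m} → Γ m
blank = Fin.zero
bit0  = Fin.suc Fin.zero
bit1  = Fin.suc (Fin.suc Fin.zero)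
sep   = Fin.suc (Fin.suc (Fin.suc Fin.zero))

encBit : ∀ {m} → Bool → Γ m
encBit false = bit0
encBit true  = bit1

enc : ∀ {m} → List Bool → ℕ → List (Γ m)
enc x k = map encBit x ++ (sep ∷ replicate k bit1)

nth : ∀ {m} → List (Γ m) → ℕ → Γ m
nth []       _       = blank
nth (a ∷ w)  zero    = a
nth (a ∷ w)  (suc i) = nth w i

HoldsWord : ∀ {m} → (ℕ → Γ m) → List (Γ m) → Set
HoldsWord {m} τ w =
  ((i : ℕ) (p : i < length w) → τ i ≡ lookup w (fromℕ< p)) × (τ (length w) ≡ blank)

upd : ∀ {A : Set} → (ℕ → A) → ℕ → A → (ℕ → A)
upd τ i a j = if j ≡ᵇ i then a else τ j

data Move : Set where
  L S R : Move

move : Move → ℕ → ℕ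
move L zero    = zero
move L (suc h) = h
move S h       = h
move R h       = suc h

moveB : ℕ → Move → ℕ → ℕ
moveB M R h = if suc h <ᵇ M then suc h else h
moveB M mv h = move mv h

record TM (m : ℕ) : Set where
  field
    Q     : ℕ
    start : Fin Q
    halt  : Fin Q → Bool
    δ     : Fin Q → Γ m → Fin Q × Γ m × Move

record TMConf {m : ℕ} (T : TM m) : Set where
  constructor tmconf
  field
    state : Fin (TM.Q T)
    tape  : ℕ → Γ m
    head  : ℕ

tmInit : ∀ {m} (T : TM m) → List (Γ m) → TMConf T
tmInit T w = tmconf (TM.start T) (nth w) zero

tmStep : ∀ {m} (T : TM m) → TMConf T → TMConf T
tmStep T (tmconf q τ h) with TM.halt T q
... | true  = tmconf q τ h
... | false with TM.δ T q (τ h)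
...   | (q' , a , mv) = tmconf q' (upd τ h a) (move mv h)

tmRun : ∀ {m} (T : TM m) → ℕ → TMConf T → TMConf T
tmRun T zero    c = c
tmRun T (suc t) c = tmRun T t (tmStep T c)

TMOutputs : ∀ {m} (T : TM m) → List (Γ m) → ℕ → List (Γ m) → Set
TMOutputs T w t v =
  let c = tmRun T t (tmInit T w) in
  (TM.halt T (TMConf.state c) ≡ true) × HoldsWord (TMConf.tape c) v

-- Convention: the address tape is a binary tape with its own
-- head, written by ordinary transitions; the address is the little-endian
-- binary value of its contents.

data Kind : Set where
  normal read write accept : Kind

record TLM (m : ℕ) : Set where
  field
    Q      : ℕ
    start  : Fin Q
    kind   : Fin Q → Kind
    -- ordinary transition: main-memory symbol and address-tape bit under heads
    δ      : Fin Q → Γ m → Bool → Fin Q × Γ m × Move × Bool × Move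
    -- after a Read/Write operation: next state and main-memory head move
    ioNext : Fin Q → Fin Q × Move

getB : List Bool → ℕ → Bool
getB []       _       = false
getB (b ∷ bs) zero    = b
getB (b ∷ bs) (suc i) = getB bs i

setB : List Bool → ℕ → Bool → List Bool
setB []       zero    b = b ∷ []
setB []       (suc i) b = false ∷ setB [] i b
setB (_ ∷ bs) zero    b = b ∷ bs
setB (x ∷ bs) (suc i) b = x ∷ setB bs i b

binVal : List Bool → ℕ
binVal []           = zero
binVal (false ∷ bs) = 2 * binVal bs
binVal (true ∷ bs)  = suc (2 * binVal bs)

record TLMConf {m : ℕ} (N : TLM m) : Set where
  constructor tlmconf
  field
    state : Fin (TLM.Q N)
    mem   : ℕ → Γ m        -- main memory (only cells 0..M-1 are reachable)
    mh    : ℕ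
    adr   : List Bool
    ah    : ℕ
    ext   : ℕ → Γ m
    time  : ℕ              -- number of ordinary transitions
    io    : ℕ              -- number of Read/Write operations

tlmInit : ∀ {m} (N : TLM m) → List (Γ m) → TLMConf N
tlmInit N w = tlmconf (TLM.start N) (λ _ → blank) zero [] zero (nth w) zero zero

tlmStep : ∀ {m} (N : TLM m) (M : ℕ) → TLMConf N → TLMConf N
tlmStep N M c@(tlmconf q μ h α ah ε t i) with TLM.kind N q
... | accept = c
... | normal with TLM.δ N q (μ h) (getB α ah)
...   | (q' , a , mv , b , amv) =
        tlmconf q' (upd μ h a) (moveB M mv h) (setB α ah b) (move amv ah) ε (suc t) i
tlmStep N M c@(tlmconf q μ h α ah ε t i) | read with TLM.ioNext N q
...   | (q' , mv) = tlmconf q' (upd μ h (ε (binVal α))) (moveB M mv h) α ah ε t (suc i)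
tlmStep N M c@(tlmconf q μ h α ah ε t i) | write with TLM.ioNext N q
...   | (q' , mv) = tlmconf q' μ (moveB M mv h) α ah (upd ε (binVal α) (μ h)) t (suc i)

tlmRun : ∀ {m} (N : TLM m) (M : ℕ) → ℕ → TLMConf N → TLMConf N
tlmRun N M zero    c = c
tlmRun N M (suc s) c = tlmRun N M s (tlmStep N M c)

{-# OPTIONS --safe #-}
module Submission where

open import Data.Bool using (Bool; true; false; not; if_then_else_; T)
open import Data.Bool.Properties using (¬-not) renaming (_≟_ to _≟ᵇ_)
open import Data.Empty using (⊥-elim)
open import Data.Fin using (Fin; fromℕ<; _↑ˡ_; _↑ʳ_; splitAt)
open import Data.Fin.Patterns using (0F; 1F; 2F; 3F; 4F; 5F; 6F)
open import Data.Fin.Properties using (splitAt-↑ˡ; splitAt-↑ʳ; +↔⊎; *↔×; 2↔Bool)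
open import Data.List using (List; []; _∷_; length; map; lookup; replicate)
open import Data.List.Properties using (length-map; map-replicate)
open import Data.Nat
open import Data.Nat.Properties
open import Data.Nat.Tactic.RingSolver using (solve-∀)
open import Data.Product using (Σ; _×_; _,_; proj₁; proj₂)
open import Data.Product.Function.NonDependent.Propositional using (_×-↩_)
open import Data.Sum using (_⊎_; inj₁; inj₂; [_,_])
open import Data.Sum.Function.Propositional using (_⊎-↩_)
open import Function using (_∘_)
open import Function.Bundles using (_⇔_; _↩_; mk↩; LeftInverse)
open import Function.Construct.Composition using (_↩-∘_)
open import Function.Construct.Identity using (↩-id)
open import Function.Properties.Inverse using (↔⇒↩)
open import Relation.Binary.PropositionalEquality using (_≡_; _≢_; _≗_; refl; sym; trans; cong; cong₂; subst; module ≡-Reasoning)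
open import Relation.Nullary using (yes; no; contradiction)

open import Defs

-- The TM-TLM keeps the tape of the reduction machine in external memory, cell i at address i, and
-- its head position h as the binary address on the address tape; main memory serves as a single
-- register, so every memory size works. A step of the simulated machine is a Read, an application
-- of its transition function, a Write and a binary increment or decrement of the address, i.e.
-- O(h) = O(t) ordinary transitions and two IO operations. Cell 0 is stored with a mark, which tells a
-- left move at the origin to stay put; after halting, the machine counts the address down to 0 and
-- erases the mark. A halting run of length t is thus simulated within time and IO 5(t+1)², and
-- t ≤ f(k)·c·(|x|+1)^d turns this into 5(c+1)²·(f(k)+1)^b·(|x|+1)^b with b = 2(d+1).

module TLMRun {m : ℕ} (N : TLM m) (M : ℕ) where

  tlmRun-+ : ∀ a b c → tlmRun N M (a + b) c ≡ tlmRun N M b (tlmRun N M a c)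
  tlmRun-+ zero    b c = refl
  tlmRun-+ (suc a) b c = tlmRun-+ a b (tlmStep N M c)

  _⇝[_]_ : TLMConf N → ℕ → TLMConf N → Set
  c ⇝[ s ] c′ = tlmRun N M s c ≡ c′

  ⇝-trans : ∀ {c c₁ c₂} a b → c ⇝[ a ] c₁ → c₁ ⇝[ b ] c₂ → c ⇝[ a + b ] c₂
  ⇝-trans {c} a b p q = trans (tlmRun-+ a b c) (trans (cong (tlmRun N M b) p) q)

  ⇝-step : ∀ {c c₁ c₂} b → tlmStep N M c ≡ c₁ → c₁ ⇝[ b ] c₂ → c ⇝[ suc b ] c₂
  ⇝-step b p q = trans (cong (tlmRun N M b) p) q

  tlmStep-normal : ∀ q μ h α ah ε t io {q′ a mv b amv} → TLM.kind N q ≡ normal →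
    TLM.δ N q (μ h) (getB α ah) ≡ (q′ , a , mv , b , amv) →
    tlmStep N M (tlmconf q μ h α ah ε t io)
      ≡ tlmconf q′ (upd μ h a) (moveB M mv h) (setB α ah b) (move amv ah) ε (suc t) io
  tlmStep-normal q μ h α ah ε t io k d rewrite k | d = refl

  tlmStep-read : ∀ q μ h α ah ε t io {q′ mv} → TLM.kind N q ≡ read →
    TLM.ioNext N q ≡ (q′ , mv) →
    tlmStep N M (tlmconf q μ h α ah ε t io)
      ≡ tlmconf q′ (upd μ h (ε (binVal α))) (moveB M mv h) α ah ε t (suc io)
  tlmStep-read q μ h α ah ε t io k d rewrite k | d = refl

  tlmStep-write : ∀ q μ h α ah ε t io {q′ mv} → TLM.kind N q ≡ write →
    TLM.ioNext N q ≡ (q′ , mv) →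
    tlmStep N M (tlmconf q μ h α ah ε t io)
      ≡ tlmconf q′ μ (moveB M mv h) α ah (upd ε (binVal α) (μ h)) t (suc io)
  tlmStep-write q μ h α ah ε t io k d rewrite k | d = refl

-- setB may append bits, so equal addresses need not be equal lists.
infix 4 _≈ᵇ_

record _≈ᵇ_ (α β : List Bool) : Set where
  constructor pointwise
  field
    getB-≡ : ∀ i → getB α i ≡ getB β i

open _≈ᵇ_

≈ᵇ-trans : ∀ {α β γ} → α ≈ᵇ β → β ≈ᵇ γ → α ≈ᵇ γ
≈ᵇ-trans e f = pointwise λ i → trans (getB-≡ e i) (getB-≡ f i)

getB-[] : ∀ i → getB [] i ≡ false
getB-[] zero    = refl
getB-[] (suc i) = refl

getB-setB-≡ : ∀ α j b → getB (setB α j b) j ≡ b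
getB-setB-≡ []      zero    b = refl
getB-setB-≡ []      (suc j) b = getB-setB-≡ [] j b
getB-setB-≡ (x ∷ α) zero    b = refl
getB-setB-≡ (x ∷ α) (suc j) b = getB-setB-≡ α j b

getB-setB-≢ : ∀ α j b i → i ≢ j → getB (setB α j b) i ≡ getB α i
getB-setB-≢ α       zero    b zero    i≢j = ⊥-elim (i≢j refl)
getB-setB-≢ []      zero    b (suc i) _   = getB-[] i
getB-setB-≢ (x ∷ α) zero    b (suc i) _   = refl
getB-setB-≢ []      (suc j) b zero    _   = refl
getB-setB-≢ (x ∷ α) (suc j) b zero    _   = refl
getB-setB-≢ []      (suc j) b (suc i) i≢j = getB-setB-≢ [] j b i (i≢j ∘ cong suc)
getB-setB-≢ (x ∷ α) (suc j) b (suc i) i≢j = getB-setB-≢ α j b i (i≢j ∘ cong suc)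

setB-getB : ∀ α j {b} → getB α j ≡ b → setB α j b ≈ᵇ α
setB-getB α j refl = pointwise bit
  where
    bit : ∀ i → getB (setB α j (getB α j)) i ≡ getB α i
    bit i with i ≟ j
    ... | yes refl = getB-setB-≡ α j _
    ... | no  i≢j  = getB-setB-≢ α j _ i i≢j

setB-cong : ∀ {α β} j b → α ≈ᵇ β → setB α j b ≈ᵇ setB β j b
setB-cong {α} {β} j b e = pointwise bit
  where
    bit : ∀ i → getB (setB α j b) i ≡ getB (setB β j b) i
    bit i with i ≟ j
    ... | yes refl = trans (getB-setB-≡ α j b) (sym (getB-setB-≡ β j b))
    ... | no  i≢j  = trans (getB-setB-≢ α j b i i≢j) (trans (getB-≡ e i) (sym (getB-setB-≢ β j b i i≢j)))

binVal-allFalse : ∀ β → (∀ i → getB β i ≡ false) → binVal β ≡ 0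
binVal-allFalse []          _ = refl
binVal-allFalse (true ∷ β)  f with f 0
... | ()
binVal-allFalse (false ∷ β) f = cong (2 *_) (binVal-allFalse β (f ∘ suc))

binVal-cong : ∀ α β → α ≈ᵇ β → binVal α ≡ binVal β
binVal-cong []      β       e = sym (binVal-allFalse β (λ i → trans (sym (getB-≡ e i)) (getB-[] i)))
binVal-cong (a ∷ α) []      e = binVal-allFalse (a ∷ α) (λ i → trans (getB-≡ e i) (getB-[] i))
binVal-cong (a ∷ α) (b ∷ β) e with getB-≡ e 0
binVal-cong (true  ∷ α) (true  ∷ β) e | refl = cong (λ v → suc (2 * v)) (binVal-cong α β (pointwise (getB-≡ e ∘ suc)))
binVal-cong (false ∷ α) (false ∷ β) e | refl = cong (2 *_) (binVal-cong α β (pointwise (getB-≡ e ∘ suc)))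

binVal-setB-getB : ∀ α j → binVal (setB α j (getB α j)) ≡ binVal α
binVal-setB-getB α j = binVal-cong (setB α j (getB α j)) α (setB-getB α j refl)

record RunFlip (u : Bool) (p : ℕ) (α α′ : List Bool) : Set where
  field
    run   : ∀ i → i < p → getB α i ≡ u
    stop  : getB α p ≡ not u
    run′  : ∀ i → i < p → getB α′ i ≡ not u
    stop′ : getB α′ p ≡ u
    above : ∀ i → p < i → getB α′ i ≡ getB α i

RunFlip-tail : ∀ {u p a a′ α α′} → RunFlip u (suc p) (a ∷ α) (a′ ∷ α′) → RunFlip u p α α′
RunFlip-tail f = record
  { run   = λ i i<p → run (suc i) (s≤s i<p)
  ; stop  = stop
  ; run′  = λ i i<p → run′ (suc i) (s≤s i<p)
  ; stop′ = stop′
  ; above = λ i p<i → above (suc i) (s≤s p<i)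
  }
  where open RunFlip f

RunFlip-swap : ∀ {p α α′} → RunFlip false p α α′ → RunFlip true p α′ α
RunFlip-swap f = record
  { run = run′ ; stop = stop′ ; run′ = run ; stop′ = stop ; above = λ i p<i → sym (above i p<i) }
  where open RunFlip f

binVal-increment : ∀ p α α′ → RunFlip true p α α′ → binVal α′ ≡ suc (binVal α)
binVal-increment p α [] f = contradiction (trans (sym (RunFlip.stop′ f)) (getB-[] p)) λ ()
binVal-increment zero [] (a′ ∷ α′) f rewrite RunFlip.stop′ f =
  cong (λ v → suc (2 * v)) (binVal-allFalse α′ (λ i → trans (RunFlip.above f (suc i) (s≤s z≤n)) (getB-[] i)))
binVal-increment zero (a ∷ α) (a′ ∷ α′) f with RunFlip.stop f | RunFlip.stop′ f
... | refl | refl = cong (λ v → suc (2 * v)) (binVal-cong α′ α (pointwise λ i → RunFlip.above f (suc i) (s≤s z≤n)))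
binVal-increment (suc p) [] (a′ ∷ α′) f = contradiction (RunFlip.run f 0 (s≤s z≤n)) λ ()
binVal-increment (suc p) (a ∷ α) (a′ ∷ α′) f with RunFlip.run f 0 (s≤s z≤n) | RunFlip.run′ f 0 (s≤s z≤n)
... | refl | refl = begin
  2 * binVal α′           ≡⟨ cong (2 *_) (binVal-increment p α α′ (RunFlip-tail f)) ⟩
  2 * suc (binVal α)      ≡⟨ cong suc (+-suc (binVal α) (binVal α + 0)) ⟩
  suc (suc (2 * binVal α)) ∎
  where open ≡-Reasoning

binVal-decrement : ∀ p α α′ → RunFlip false p α α′ → binVal α ≡ suc (binVal α′)
binVal-decrement p α α′ f = binVal-increment p α′ α (RunFlip-swap f)

firstNot : Bool → List Bool → ℕ
firstNot u       []          = 0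
firstNot true    (true ∷ α)  = suc (firstNot true α)
firstNot false   (false ∷ α) = suc (firstNot false α)
firstNot _       _           = 0

getB-<firstNot : ∀ u α i → i < firstNot u α → getB α i ≡ u
getB-<firstNot true  (true  ∷ α) zero    _         = refl
getB-<firstNot true  (true  ∷ α) (suc i) (s≤s i<p) = getB-<firstNot true α i i<p
getB-<firstNot false (false ∷ α) zero    _         = refl
getB-<firstNot false (false ∷ α) (suc i) (s≤s i<p) = getB-<firstNot false α i i<p

getB-firstNot-true : ∀ α → getB α (firstNot true α) ≡ false
getB-firstNot-true []          = refl
getB-firstNot-true (true ∷ α)  = getB-firstNot-true α
getB-firstNot-true (false ∷ α) = refl

getB-firstNot-false : ∀ α {v} → binVal α ≡ suc v → getB α (firstNot false α) ≡ true
getB-firstNot-false (true  ∷ α) _ = refl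
getB-firstNot-false (false ∷ α) e with binVal α in eq
... | suc _ = getB-firstNot-false α eq

ones≤binVal : ∀ p β → (∀ i → i < p → getB β i ≡ true) → p ≤ binVal β
ones≤binVal zero    β           _ = z≤n
ones≤binVal (suc p) []          h = contradiction (h 0 (s≤s z≤n)) λ ()
ones≤binVal (suc p) (false ∷ β) h = contradiction (h 0 (s≤s z≤n)) λ ()
ones≤binVal (suc p) (true ∷ β)  h =
  s≤s (≤-trans (ones≤binVal p β (λ i i<p → h (suc i) (s≤s i<p))) (m≤m+n (binVal β) _))

move≤suc : ∀ mv h → move mv h ≤ suc h
move≤suc L zero    = z≤n
move≤suc L (suc h) = m≤n⇒m≤1+n (n≤1+n h)
move≤suc S h       = n≤1+n h
move≤suc R h       = ≤-refl

module TMRun {m : ℕ} (T : TM m) where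

  Halted : TMConf T → Set
  Halted c = TM.halt T (TMConf.state c) ≡ true

  tmRun-+ : ∀ a b c → tmRun T (a + b) c ≡ tmRun T b (tmRun T a c)
  tmRun-+ zero    b c = refl
  tmRun-+ (suc a) b c = tmRun-+ a b (tmStep T c)

  tmStep-running : ∀ q τ h → TM.halt T q ≡ false →
    let (q′ , a , mv) = TM.δ T q (τ h) in tmStep T (tmconf q τ h) ≡ tmconf q′ (upd τ h a) (move mv h)
  tmStep-running q τ h e rewrite e = refl

  tmStep-halted : ∀ c → Halted c → tmStep T c ≡ c
  tmStep-halted (tmconf q τ h) e rewrite e = refl

  tmRun-halted : ∀ r c → Halted c → tmRun T r c ≡ c
  tmRun-halted zero    c e = refl
  tmRun-halted (suc r) c e = trans (cong (tmRun T r) (tmStep-halted c e)) (tmRun-halted r c e)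

  tmRun-halted-≤ : ∀ c {r₁ r₂} → r₁ ≤ r₂ → Halted (tmRun T r₁ c) → tmRun T r₂ c ≡ tmRun T r₁ c
  tmRun-halted-≤ c {r₁} {r₂} r₁≤r₂ h = begin
    tmRun T r₂ c                          ≡⟨ cong (λ r → tmRun T r c) (sym (m+[n∸m]≡n r₁≤r₂)) ⟩
    tmRun T (r₁ + (r₂ ∸ r₁)) c            ≡⟨ tmRun-+ r₁ (r₂ ∸ r₁) c ⟩
    tmRun T (r₂ ∸ r₁) (tmRun T r₁ c)      ≡⟨ tmRun-halted (r₂ ∸ r₁) _ h ⟩
    tmRun T r₁ c                          ∎
    where open ≡-Reasoning

  halted-unique : ∀ c r₁ r₂ → Halted (tmRun T r₁ c) → Halted (tmRun T r₂ c) → tmRun T r₁ c ≡ tmRun T r₂ c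
  halted-unique c r₁ r₂ h₁ h₂ with ≤-total r₁ r₂
  ... | inj₁ r₁≤r₂ = sym (tmRun-halted-≤ c r₁≤r₂ h₁)
  ... | inj₂ r₂≤r₁ = tmRun-halted-≤ c r₂≤r₁ h₂

  tmStep-head≤ : ∀ c → TMConf.head (tmStep T c) ≤ suc (TMConf.head c)
  tmStep-head≤ (tmconf q τ h) with TM.halt T q
  ... | true  = n≤1+n h
  ... | false = move≤suc (proj₂ (proj₂ (TM.δ T q (τ h)))) h

  tmRun-head≤ : ∀ r c → TMConf.head (tmRun T r c) ≤ r + TMConf.head c
  tmRun-head≤ zero    c = ≤-refl
  tmRun-head≤ (suc r) c = begin
    TMConf.head (tmRun T r (tmStep T c)) ≤⟨ tmRun-head≤ r (tmStep T c) ⟩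
    r + TMConf.head (tmStep T c)         ≤⟨ +-monoʳ-≤ r (tmStep-head≤ c) ⟩
    r + suc (TMConf.head c)              ≡⟨ +-suc r _ ⟩
    suc r + TMConf.head c                ∎
    where open ≤-Reasoning

lookup-nth : ∀ {n} (w : List (Γ n)) i (i<∣w∣ : i < length w) → lookup w (fromℕ< i<∣w∣) ≡ nth w i
lookup-nth (a ∷ w) zero    _         = refl
lookup-nth (a ∷ w) (suc i) (s≤s i<∣w∣) = lookup-nth w i i<∣w∣

nth-map : ∀ {m n} (f : Γ m → Γ n) w i → f blank ≡ blank → nth (map f w) i ≡ f (nth w i)
nth-map f []      i       fb = sym fb
nth-map f (a ∷ w) zero    fb = refl
nth-map f (a ∷ w) (suc i) fb = nth-map f w i fb

HoldsWord-map : ∀ {m n} (f : Γ m → Γ n) → f blank ≡ blank →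
  ∀ {τ τ′} v → τ′ ≗ f ∘ τ → HoldsWord τ v → HoldsWord τ′ (map f v)
HoldsWord-map f fb {τ} {τ′} v τ′≗ (τ≡v , τ-end) = word , end
  where
    word : ∀ i (i<∣fv∣ : i < length (map f v)) → τ′ i ≡ lookup (map f v) (fromℕ< i<∣fv∣)
    word i i<∣fv∣ = begin
      τ′ i                            ≡⟨ τ′≗ i ⟩
      f (τ i)                         ≡⟨ cong f (τ≡v i i<∣v∣) ⟩
      f (lookup v (fromℕ< i<∣v∣))     ≡⟨ cong f (lookup-nth v i i<∣v∣) ⟩
      f (nth v i)                     ≡⟨ sym (nth-map f v i fb) ⟩
      nth (map f v) i                 ≡⟨ sym (lookup-nth (map f v) i i<∣fv∣) ⟩
      lookup (map f v) (fromℕ< i<∣fv∣) ∎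
      where
        open ≡-Reasoning
        i<∣v∣ = subst (i <_) (length-map f v) i<∣fv∣
    end : τ′ (length (map f v)) ≡ blank
    end rewrite length-map f v = trans (τ′≗ (length v)) (trans (cong f τ-end) fb)

retract : ∀ {A B : Set} (to : A → B) (from : B → A) → (∀ b → to (from b) ≡ b) → A ↩ B
retract to from inv = mk↩ {to = to} {from = from} λ { {b} refl → inv b }

fin-⊎ : ∀ {a b} {A B : Set} → Fin a ↩ A → Fin b ↩ B → Fin (a + b) ↩ (A ⊎ B)
fin-⊎ fA fB = (fA ⊎-↩ fB) ↩-∘ ↔⇒↩ +↔⊎

fin-× : ∀ {a b} {A B : Set} → Fin a ↩ A → Fin b ↩ B → Fin (a * b) ↩ (A × B)
fin-× fA fB = (fA ×-↩ fB) ↩-∘ ↔⇒↩ *↔×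

fin-Move : Fin 3 ↩ Move
fin-Move = retract (λ { 0F → L ; 1F → S ; 2F → R }) (λ { L → 0F ; S → 1F ; R → 2F })
  λ { L → refl ; S → refl ; R → refl }

module Simulator {m : ℕ} (Red : TM m) where
  open TMRun Red


  m′ : ℕ
  m′ = m + (4 + m)

  Q₀ : ℕ
  Q₀ = TM.Q Red

  plain marked : Γ m → Γ m′
  plain  a = a ↑ˡ (4 + m)
  marked a = (4 + m) ↑ʳ a

  tag : Bool → Γ m → Γ m′
  tag false = plain
  tag true  = marked

  untag : Γ m′ → Bool × Γ m
  untag s with splitAt (4 + m) s
  ... | inj₁ a = false , a
  ... | inj₂ a = true  , a

  untag-tag : ∀ z a → untag (tag z a) ≡ (z , a)
  untag-tag false a rewrite splitAt-↑ˡ (4 + m) a (4 + m) = refl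
  untag-tag true  a rewrite splitAt-↑ʳ (4 + m) (4 + m) a = refl

  isZero : ℕ → Bool
  isZero zero    = true
  isZero (suc _) = false

  markedTape : (ℕ → Γ m) → ℕ → Γ m′
  markedTape τ i = tag (isZero i) (τ i)

  markedTape-upd : ∀ {τ ε} h a → ε ≗ markedTape τ → upd ε h (tag (isZero h) a) ≗ markedTape (upd τ h a)
  markedTape-upd {τ} h a ε≗ i with i ≡ᵇ h in i≡ᵇh
  ... | true rewrite ≡ᵇ⇒≡ i h (subst T (sym i≡ᵇh) _) = refl
  ... | false = ε≗ i

  data Control : Set where
    readOrigin markOrigin writeOrigin seekRead seekCheck unmarkOrigin done : Control

  data Phase : Set where
    simulate fetch apply : Phase

  data Sweep : Set where
    start scan back : Sweep

  data Cont : Set where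
    resume : Fin Q₀ → Cont
    seek   : Cont

  -- In store q mv z the flag z records whether the simulated head is on cell 0; counter w u c
  -- increments (u = true) or decrements (u = false) the address and then continues with c.
  data St : Set where
    control : Control → St
    phase   : Phase → Fin Q₀ → St
    store   : Fin Q₀ → Move → Bool → St
    counter : Sweep → Bool → Cont → St

  fin-Control : Fin 7 ↩ Control
  fin-Control = retract
    (λ { 0F → readOrigin ; 1F → markOrigin ; 2F → writeOrigin ; 3F → seekRead
       ; 4F → seekCheck ; 5F → unmarkOrigin ; 6F → done })
    (λ { readOrigin → 0F ; markOrigin → 1F ; writeOrigin → 2F ; seekRead → 3F
       ; seekCheck → 4F ; unmarkOrigin → 5F ; done → 6F })
    (λ { readOrigin → refl ; markOrigin → refl ; writeOrigin → refl ; seekRead → refl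
       ; seekCheck → refl ; unmarkOrigin → refl ; done → refl })

  fin-Phase : Fin 3 ↩ Phase
  fin-Phase = retract (λ { 0F → simulate ; 1F → fetch ; 2F → apply })
    (λ { simulate → 0F ; fetch → 1F ; apply → 2F }) λ { simulate → refl ; fetch → refl ; apply → refl }

  fin-Sweep : Fin 3 ↩ Sweep
  fin-Sweep = retract (λ { 0F → start ; 1F → scan ; 2F → back })
    (λ { start → 0F ; scan → 1F ; back → 2F }) λ { start → refl ; scan → refl ; back → refl }

  fin-Cont : Fin (Q₀ + 1) ↩ Cont
  fin-Cont = retract [ resume , (λ _ → seek) ] (λ { (resume q) → inj₁ q ; seek → inj₂ 0F })
    (λ { (resume q) → refl ; seek → refl }) ↩-∘ ↔⇒↩ +↔⊎

  Q : ℕ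
  Q = 7 + (3 * Q₀ + (Q₀ * (3 * 2) + 3 * (2 * (Q₀ + 1))))

  fin-St : Fin Q ↩ St
  fin-St = retract fromCode toCode fromCode-toCode ↩-∘
    fin-⊎ fin-Control (fin-⊎ (fin-× fin-Phase (↩-id (Fin Q₀)))
      (fin-⊎ (fin-× (↩-id (Fin Q₀)) (fin-× fin-Move (↔⇒↩ 2↔Bool)))
        (fin-× fin-Sweep (fin-× (↔⇒↩ 2↔Bool) fin-Cont))))
    where
      Code : Set
      Code = Control ⊎ (Phase × Fin Q₀) ⊎ (Fin Q₀ × Move × Bool) ⊎ (Sweep × Bool × Cont)
      fromCode : Code → St
      fromCode (inj₁ c)                         = control c
      fromCode (inj₂ (inj₁ (p , q)))            = phase p q
      fromCode (inj₂ (inj₂ (inj₁ (q , mv , z)))) = store q mv z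
      fromCode (inj₂ (inj₂ (inj₂ (w , u , c)))) = counter w u c
      toCode : St → Code
      toCode (control c)     = inj₁ c
      toCode (phase p q)     = inj₂ (inj₁ (p , q))
      toCode (store q mv z)  = inj₂ (inj₂ (inj₁ (q , mv , z)))
      toCode (counter w u c) = inj₂ (inj₂ (inj₂ (w , u , c)))
      fromCode-toCode : ∀ s → fromCode (toCode s) ≡ s
      fromCode-toCode (control _)     = refl
      fromCode-toCode (phase _ _)     = refl
      fromCode-toCode (store _ _ _)   = refl
      fromCode-toCode (counter _ _ _) = refl

  encode : St → Fin Q
  encode = LeftInverse.from fin-St

  decode : Fin Q → St
  decode = LeftInverse.to fin-St

  decode-encode : ∀ s → decode (encode s) ≡ s
  decode-encode = LeftInverse.strictlyInverseˡ fin-St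

  q₀ : Fin Q₀
  q₀ = TM.start Red

  resumeState : Cont → St
  resumeState (resume q) = phase simulate q
  resumeState seek       = control seekRead

  kindOf : St → Kind
  kindOf (control readOrigin)   = read
  kindOf (control markOrigin)   = normal
  kindOf (control writeOrigin)  = write
  kindOf (control seekRead)     = read
  kindOf (control seekCheck)    = normal
  kindOf (control unmarkOrigin) = write
  kindOf (control done)         = accept
  kindOf (phase simulate _)     = normal
  kindOf (phase fetch _)        = read
  kindOf (phase apply _)        = normal
  kindOf (store _ _ _)          = write
  kindOf (counter _ _ _)        = normal

  afterStore : Fin Q₀ → Move → Bool → St
  afterStore q S _     = phase simulate q
  afterStore q L true  = phase simulate q
  afterStore q L false = counter start false (resume q)
  afterStore q R _     = counter start true (resume q)

  afterIO : St → St
  afterIO (control readOrigin)   = control markOrigin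
  afterIO (control writeOrigin)  = phase simulate q₀
  afterIO (control seekRead)     = control seekCheck
  afterIO (control unmarkOrigin) = control done
  afterIO (phase fetch q)        = phase apply q
  afterIO (store q mv z)         = afterStore q mv z
  afterIO _                      = control done

  Action : Set
  Action = St × Bool × Move

  -- The counter scans right over the run of u's at the bottom of the address, sets the bit that stops
  -- it to u, and walks back writing ¬u. A left move from cell 0 stays put, so the walk back ends at
  -- cell 0, which it has just turned into ¬u.
  onRun offRun : Sweep → Bool → Cont → Action
  onRun start u c = counter scan u c , u , R
  onRun scan  u c = counter scan u c , u , R
  onRun back  u c = counter back u c , not u , L
  offRun start u c = resumeState c , u , S
  offRun scan  u c = counter back u c , u , L
  offRun back  u c = resumeState c , not u , S

  sweep : Sweep → Bool → Cont → Bool → Action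
  sweep w true  c true  = onRun w true c
  sweep w true  c false = offRun w true c
  sweep w false c false = onRun w false c
  sweep w false c true  = offRun w false c

  sweep-on : ∀ w u c → sweep w u c u ≡ onRun w u c
  sweep-on w true  c = refl
  sweep-on w false c = refl

  sweep-off : ∀ w u c → sweep w u c (not u) ≡ offRun w u c
  sweep-off w true  c = refl
  sweep-off w false c = refl

  checkOrigin : Bool × Γ m → Γ m′ → Bool → St × Γ m′ × Bool × Move
  checkOrigin (true  , a) _ b = control unmarkOrigin , plain a , b , S
  checkOrigin (false , _) s b = counter start false seek , s , b , S

  applyRed : Fin Q₀ → Bool × Γ m → Bool → St × Γ m′ × Bool × Move
  applyRed q (z , a) b = let (q′ , a′ , mv) = TM.δ Red q a in store q′ mv z , tag z a′ , b , S

  transition : St → Γ m′ → Bool → St × Γ m′ × Bool × Move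
  transition (control markOrigin) s b = control writeOrigin , marked (proj₂ (untag s)) , b , S
  transition (control seekCheck)  s b = checkOrigin (untag s) s b
  transition (phase simulate q)   s b = (if TM.halt Red q then control seekRead else phase fetch q) , s , b , S
  transition (phase apply q)      s b = applyRed q (untag s) b
  transition (counter w u c)      s b = let (st , b′ , amv) = sweep w u c b in st , s , b′ , amv
  transition _                    s b = control done , s , b , S

  toTLMOutput : St × Γ m′ × Bool × Move → Fin Q × Γ m′ × Move × Bool × Move
  toTLMOutput (st , s , b , amv) = encode st , s , S , b , amv

  simulator : TLM m′
  simulator = record
    { Q      = Q
    ; start  = encode (control readOrigin)
    ; kind   = kindOf ∘ decode
    ; δ      = λ i s b → toTLMOutput (transition (decode i) s b)
    ; ioNext = λ i → encode (afterIO (decode i)) , S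
    }

  module Execution (M : ℕ) where
    open TLMRun simulator M

    cfg : St → (ℕ → Γ m′) → List Bool → ℕ → (ℕ → Γ m′) → ℕ → ℕ → TLMConf simulator
    cfg st μ α ah ε t io = tlmconf (encode st) μ 0 α ah ε t io

    normal-step : ∀ st {μ α ah ε t io st′ s b amv} → kindOf st ≡ normal →
      transition st (μ 0) (getB α ah) ≡ (st′ , s , b , amv) →
      tlmStep simulator M (cfg st μ α ah ε t io) ≡ cfg st′ (upd μ 0 s) (setB α ah b) (move amv ah) ε (suc t) io
    normal-step st {μ} {α} {ah} {ε} {t} {io} k e =
      tlmStep-normal (encode st) μ 0 α ah ε t io (trans (cong kindOf (decode-encode st)) k)
        (cong toTLMOutput (trans (cong (λ x → transition x (μ 0) (getB α ah)) (decode-encode st)) e))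

    read-step : ∀ st {μ α ah ε t io} → kindOf st ≡ read →
      tlmStep simulator M (cfg st μ α ah ε t io) ≡ cfg (afterIO st) (upd μ 0 (ε (binVal α))) α ah ε t (suc io)
    read-step st {μ} {α} {ah} {ε} {t} {io} k =
      tlmStep-read (encode st) μ 0 α ah ε t io (trans (cong kindOf (decode-encode st)) k)
        (cong (λ x → encode (afterIO x) , S) (decode-encode st))

    write-step : ∀ st {μ α ah ε t io} → kindOf st ≡ write →
      tlmStep simulator M (cfg st μ α ah ε t io) ≡ cfg (afterIO st) μ α ah (upd ε (binVal α) (μ 0)) t (suc io)
    write-step st {μ} {α} {ah} {ε} {t} {io} k =
      tlmStep-write (encode st) μ 0 α ah ε t io (trans (cong kindOf (decode-encode st)) k)
        (cong (λ x → encode (afterIO x) , S) (decode-encode st))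

    record Reaches (c : TLMConf simulator) (st : St) (ah : ℕ)
                   (P : List Bool → (ℕ → Γ m′) → ℕ → ℕ → Set) : Set where
      constructor reaches
      field
        steps : ℕ
        mem   : ℕ → Γ m′
        addr  : List Bool
        ext   : ℕ → Γ m′
        time  : ℕ
        ios   : ℕ
        run   : c ⇝[ steps ] cfg st mem addr ah ext time ios
        holds : P addr ext time ios

    stay : ∀ {st μ α ah ε t io P} → P α ε t io → Reaches (cfg st μ α ah ε t io) st ah P
    stay {μ = μ} {α} {ε = ε} {t} {io} p = reaches 0 μ α ε t io refl p

    infixr 5 _▹_
    infixl 4 _>>=_

    _▹_ : ∀ {c c′ st ah P} → tlmStep simulator M c ≡ c′ → Reaches c′ st ah P → Reaches c st ah P
    e ▹ reaches s μ α ε t io r p = reaches (suc s) μ α ε t io (⇝-step s e r) p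

    _>>=_ : ∀ {c st ah st′ ah′ P Q} → Reaches c st ah P →
      (∀ {μ α ε t io} → P α ε t io → Reaches (cfg st μ α ah ε t io) st′ ah′ Q) → Reaches c st′ ah′ Q
    reaches s μ α ε t io r p >>= k with k {μ} {α} {ε} {t} {io} p
    ... | reaches s′ μ′ α′ ε′ t′ io′ r′ q = reaches (s + s′) μ′ α′ ε′ t′ io′ (⇝-trans s s′ r r′) q

    weaken : ∀ {c st ah} {P Q : List Bool → (ℕ → Γ m′) → ℕ → ℕ → Set} →
      (∀ {α ε t io} → P α ε t io → Q α ε t io) → Reaches c st ah P → Reaches c st ah Q
    weaken f (reaches s μ α ε t io r p) = reaches s μ α ε t io r (f p)

    Internal : (ℕ → Γ m′) → ℕ → (List Bool → ℕ → Set) → List Bool → (ℕ → Γ m′) → ℕ → ℕ → Set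
    Internal ε io P α′ ε′ t′ io′ = ε′ ≡ ε × io′ ≡ io × P α′ t′

    counter-step : ∀ w u c {μ α ah ε t io st b amv} → sweep w u c (getB α ah) ≡ (st , b , amv) →
      tlmStep simulator M (cfg (counter w u c) μ α ah ε t io)
        ≡ cfg st (upd μ 0 (μ 0)) (setB α ah b) (move amv ah) ε (suc t) io
    counter-step w u c {μ} e = normal-step (counter w u c) refl (cong (λ (st , b , amv) → st , μ 0 , b , amv) e)

    on-run : ∀ w u c {μ α ah ε t io} → getB α ah ≡ u →
      let (st , b , amv) = onRun w u c in
      tlmStep simulator M (cfg (counter w u c) μ α ah ε t io)
        ≡ cfg st (upd μ 0 (μ 0)) (setB α ah b) (move amv ah) ε (suc t) io
    on-run w u c e = counter-step w u c (trans (cong (sweep w u c) e) (sweep-on w u c))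

    off-run : ∀ w u c {μ α ah ε t io} → getB α ah ≡ not u →
      let (st , b , amv) = offRun w u c in
      tlmStep simulator M (cfg (counter w u c) μ α ah ε t io)
        ≡ cfg st (upd μ 0 (μ 0)) (setB α ah b) (move amv ah) ε (suc t) io
    off-run w u c e = counter-step w u c (trans (cong (sweep w u c) e) (sweep-off w u c))

    scan-run : ∀ u c r j {μ α ε t io} → (∀ i → i < r → getB α (j + i) ≡ u) → getB α (j + r) ≡ not u →
      Reaches (cfg (counter scan u c) μ α j ε t io) (counter back u c) (move L (j + r))
        (Internal ε io λ α′ t′ → α′ ≈ᵇ setB α (j + r) u × t′ ≡ suc r + t)
    scan-run u c zero j _ stop rewrite +-identityʳ j =
      off-run scan u c stop ▹ stay (refl , refl , pointwise (λ _ → refl) , refl)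
    scan-run u c (suc r) j {μ} {α} {ε} {t} {io} run stop =
      on-run scan u c run₀ ▹ subst (λ k → Reaches (cfg (counter scan u c) (upd μ 0 (μ 0)) (setB α j u) (suc j) ε (suc t) io)
                                                   (counter back u c) (move L k) Goal) (sym (+-suc j r))
        (weaken shift (scan-run u c r (suc j) run₁ (trans (getB-setB-≢ α j u (suc j + r) (≢j r)) stop₁)))
      where
        run₀ : getB α j ≡ u
        run₀ = subst (λ k → getB α k ≡ u) (+-identityʳ j) (run 0 z<s)
        ≢j : ∀ i → suc j + i ≢ j
        ≢j i e = m≢1+m+n j (sym e)
        run₁ : ∀ i → i < r → getB (setB α j u) (suc j + i) ≡ u
        run₁ i i<r = trans (getB-setB-≢ α j u _ (≢j i)) (subst (λ k → getB α k ≡ u) (+-suc j i) (run (suc i) (s≤s i<r)))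
        stop₁ : getB α (suc j + r) ≡ not u
        stop₁ = subst (λ k → getB α k ≡ not u) (+-suc j r) stop
        Goal : List Bool → (ℕ → Γ m′) → ℕ → ℕ → Set
        Goal = Internal ε io λ α′ t′ → α′ ≈ᵇ setB α (j + suc r) u × t′ ≡ suc (suc r) + t
        shift : ∀ {α′ ε′ t′ io′} →
          Internal ε io (λ α′ t′ → α′ ≈ᵇ setB (setB α j u) (suc j + r) u × t′ ≡ suc r + suc t) α′ ε′ t′ io′ →
          Goal α′ ε′ t′ io′
        shift (refl , refl , α′≈ , refl) =
          refl , refl ,
          ≈ᵇ-trans α′≈ (≈ᵇ-trans (setB-cong (suc j + r) u (setB-getB α j run₀))
                                 (pointwise λ i → cong (λ k → getB (setB α k u) i) (sym (+-suc j r)))) ,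
          cong suc (+-suc r t)

    back-run : ∀ u c j {μ α ε t io} → (∀ i → i ≤ j → getB α i ≡ u) →
      Reaches (cfg (counter back u c) μ α j ε t io) (resumeState c) 0
        (Internal ε io λ α′ t′ → (∀ i → i ≤ j → getB α′ i ≡ not u) × (∀ i → j < i → getB α′ i ≡ getB α i)
                                 × t′ ≡ 2 + j + t)
    back-run u c zero {α = α} run =
      on-run back u c (run 0 z≤n) ▹ off-run back u c (getB-setB-≡ α 0 (not u)) ▹
      stay (refl , refl , (λ { zero _ → getB-setB-≡ α₁ 0 (not u) }) ,
            (λ { (suc i) _ → trans (getB-setB-≢ α₁ 0 (not u) (suc i) λ ()) (getB-setB-≢ α 0 (not u) (suc i) λ ()) }) ,
            refl)
      where α₁ = setB α 0 (not u)
    back-run u c (suc j) {μ} {α} {ε} {t} {io} run =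
      on-run back u c (run (suc j) ≤-refl) ▹ weaken (λ {α′} → extend {α′}) (back-run u c j run₁)
      where
        run₁ : ∀ i → i ≤ j → getB (setB α (suc j) (not u)) i ≡ u
        run₁ i i≤j = trans (getB-setB-≢ α (suc j) (not u) i (<⇒≢ (s≤s i≤j))) (run i (m≤n⇒m≤1+n i≤j))
        extend : ∀ {α′ ε′ t′ io′} →
          Internal ε io (λ α′ t′ → (∀ i → i ≤ j → getB α′ i ≡ not u)
                                   × (∀ i → j < i → getB α′ i ≡ getB (setB α (suc j) (not u)) i)
                                   × t′ ≡ 2 + j + suc t) α′ ε′ t′ io′ →
          Internal ε io (λ α′ t′ → (∀ i → i ≤ suc j → getB α′ i ≡ not u) × (∀ i → suc j < i → getB α′ i ≡ getB α i)
                                   × t′ ≡ 2 + suc j + t) α′ ε′ t′ io′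
        extend {α′} (refl , refl , below , above , refl) = refl , refl , below′ , above′ , +-suc (2 + j) t
          where
            below′ : ∀ i → i ≤ suc j → getB α′ i ≡ not u
            below′ i i≤ with m≤n⇒m<n∨m≡n i≤
            ... | inj₁ i<1+j = below i (≤-pred i<1+j)
            ... | inj₂ refl  = trans (above (suc j) ≤-refl) (getB-setB-≡ α (suc j) (not u))
            above′ : ∀ i → suc j < i → getB α′ i ≡ getB α i
            above′ i 1+j<i = trans (above i (<⇒≤ 1+j<i)) (getB-setB-≢ α (suc j) (not u) i (>⇒≢ 1+j<i))

    counter-run : ∀ u c p {μ α ε t io} → (∀ i → i < p → getB α i ≡ u) → getB α p ≡ not u →
      Reaches (cfg (counter start u c) μ α 0 ε t io) (resumeState c) 0
        (Internal ε io λ α′ t′ → RunFlip u p α α′ × t′ ≤ 2 * p + 2 + t)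
    counter-run u c zero {α = α} {t = t} run stop =
      off-run start u c stop ▹
      stay (refl , refl ,
            record { run = run ; stop = stop ; run′ = λ _ () ; stop′ = getB-setB-≡ α 0 u
                   ; above = λ i 0<i → getB-setB-≢ α 0 u i (>⇒≢ 0<i) } ,
            n≤1+n (suc t))
    counter-run u c (suc r) {μ} {α} {ε} {t} {io} run stop =
      on-run start u c (run 0 z<s) ▹
      scan-run u c r 1 (λ i i<r → trans (getB-setB-≢ α 0 u (suc i) λ ()) (run (suc i) (s≤s i<r)))
                       (trans (getB-setB-≢ α 0 u (suc r) λ ()) stop) >>= λ { {α = α₂} (refl , refl , α₂≈ , refl) →
      weaken (λ {α′} → finish α₂ α₂≈ {α′}) (back-run u c r (λ i i≤r → trans (getB-≡ (≈ᵇ-trans α₂≈ (α₁≈ (suc r))) i)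
          (trans (getB-setB-≢ α (suc r) u i (<⇒≢ (s≤s i≤r))) (run i (s≤s i≤r))))) }
      where
        α₁ = setB α 0 u
        α₁≈ : ∀ k → setB α₁ k u ≈ᵇ setB α k u
        α₁≈ k = setB-cong k u (setB-getB α 0 (run 0 z<s))
        finish : ∀ α₂ → α₂ ≈ᵇ setB α₁ (suc r) u → ∀ {α′ ε′ t′ io′} →
          Internal ε io (λ α′ t′ → (∀ i → i ≤ r → getB α′ i ≡ not u) × (∀ i → r < i → getB α′ i ≡ getB α₂ i)
                                   × t′ ≡ 2 + r + (suc r + suc t)) α′ ε′ t′ io′ →
          Internal ε io (λ α′ t′ → RunFlip u (suc r) α α′ × t′ ≤ 2 * suc r + 2 + t) α′ ε′ t′ io′
        finish α₂ α₂≈ (refl , refl , below , above , refl) =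
          refl , refl ,
          record
            { run   = run
            ; stop  = stop
            ; run′  = λ i i<1+r → below i (≤-pred i<1+r)
            ; stop′ = trans (above (suc r) ≤-refl) (trans (getB-≡ α₂≈ (suc r)) (getB-setB-≡ α₁ (suc r) u))
            ; above = λ i 1+r<i → trans (above i (<⇒≤ 1+r<i))
                        (trans (getB-≡ (≈ᵇ-trans α₂≈ (α₁≈ (suc r))) i) (getB-setB-≢ α (suc r) u i (>⇒≢ 1+r<i)))
            } ,
          ≤-reflexive (time r t)
          where
            time : ∀ r t → 2 + r + (suc r + suc t) ≡ 2 * suc r + 2 + t
            time = solve-∀

    increment : ∀ c {μ α ε t io} →
      Reaches (cfg (counter start true c) μ α 0 ε t io) (resumeState c) 0
        (Internal ε io λ α′ t′ → binVal α′ ≡ suc (binVal α) × t′ ≤ 2 * binVal α + 2 + t)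
    increment c {α = α} {t = t} =
      weaken (λ { {α′} (refl , refl , flip , t′≤) →
                  refl , refl , binVal-increment p α α′ flip , ≤-trans t′≤ (+-monoˡ-≤ t (+-monoˡ-≤ 2 (*-monoʳ-≤ 2 p≤))) })
        (counter-run true c p (getB-<firstNot true α) (getB-firstNot-true α))
      where
        p = firstNot true α
        p≤ : p ≤ binVal α
        p≤ = ones≤binVal p α (getB-<firstNot true α)

    decrement : ∀ c {μ α ε t io v} → binVal α ≡ suc v →
      Reaches (cfg (counter start false c) μ α 0 ε t io) (resumeState c) 0
        (Internal ε io λ α′ t′ → binVal α′ ≡ v × t′ ≤ 2 * v + 2 + t)
    decrement c {α = α} {t = t} {v} α≡1+v =
      weaken (λ { {α′} (refl , refl , flip , t′≤) →
                  let α′≡v = suc-injective (trans (sym (binVal-decrement p α α′ flip)) α≡1+v) in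
                  refl , refl , α′≡v ,
                  ≤-trans t′≤ (+-monoˡ-≤ t (+-monoˡ-≤ 2 (*-monoʳ-≤ 2
                    (≤-trans (ones≤binVal p α′ (RunFlip.run′ flip)) (≤-reflexive α′≡v))))) })
        (counter-run false c p (getB-<firstNot false α) (getB-firstNot-false α α≡1+v))
      where p = firstNot false α

    move-head : ∀ q mv h {μ α ε t io} → binVal α ≡ h →
      Reaches (cfg (afterStore q mv (isZero h)) μ α 0 ε t io) (phase simulate q) 0
        (Internal ε io λ α′ t′ → binVal α′ ≡ move mv h × t′ ≤ 2 * h + 2 + t)
    move-head q S h       {t = t} α≡h = stay (refl , refl , α≡h , m≤n+m t _)
    move-head q L zero    {t = t} α≡h = stay (refl , refl , α≡h , m≤n+m t _)
    move-head q L (suc h) {t = t} α≡h =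
      weaken (λ { (refl , refl , α′≡h , t′≤) →
                  refl , refl , α′≡h , ≤-trans t′≤ (+-monoˡ-≤ t (+-monoˡ-≤ 2 (*-monoʳ-≤ 2 (n≤1+n h)))) })
        (decrement (resume q) α≡h)
    move-head q R h       refl = increment (resume q)

    Encodes : TMConf Red → List Bool → (ℕ → Γ m′) → Set
    Encodes c α ε = binVal α ≡ TMConf.head c × ε ≗ markedTape (TMConf.tape c)

    checked : ∀ α {ε τ h} → binVal α ≡ h → ε ≗ markedTape τ → untag (ε (binVal α)) ≡ (isZero h , τ h)
    checked α {ε} {τ} {h} α≡h ε≗ = trans (cong untag (trans (cong ε α≡h) (ε≗ h))) (untag-tag (isZero h) (τ h))

    simulate-step : ∀ q τ h {μ α ε t io} → TM.halt Red q ≡ false → Encodes (tmconf q τ h) α ε →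
      let (q′ , a′ , mv) = TM.δ Red q (τ h) in
      Reaches (cfg (phase simulate q) μ α 0 ε t io) (phase simulate q′) 0
        (λ α′ ε′ t′ io′ → Encodes (tmconf q′ (upd τ h a′) (move mv h)) α′ ε′ × t′ ≤ 2 * h + 4 + t × io′ ≡ 2 + io)
    simulate-step q τ h {μ} {α} {ε} {t} {io} running (α≡h , ε≗) =
      normal-step (phase simulate q) refl (cong (λ b → (if b then control seekRead else phase fetch q) , μ 0 , getB α 0 , S) running) ▹
      read-step (phase fetch q) refl ▹
      normal-step (phase apply q) refl (cong (λ za → applyRed q za (getB α₁ 0)) (checked α₁ α₁≡h ε≗)) ▹
      write-step (store q′ mv (isZero h)) refl ▹
      weaken (λ { (refl , refl , α′≡ , t′≤) → (α′≡ , ε′≗) , ≤-trans t′≤ (≤-reflexive (time h t)) , refl })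
        (move-head q′ mv h (trans (binVal-setB-getB α₁ 0) α₁≡h))
      where
        q′  = proj₁ (TM.δ Red q (τ h))
        a′  = proj₁ (proj₂ (TM.δ Red q (τ h)))
        mv  = proj₂ (proj₂ (TM.δ Red q (τ h)))
        α₁  = setB α 0 (getB α 0)
        α₁≡h : binVal α₁ ≡ h
        α₁≡h = trans (binVal-setB-getB α 0) α≡h
        ε′≗ : upd ε (binVal (setB α₁ 0 (getB α₁ 0))) (tag (isZero h) a′) ≗ markedTape (upd τ h a′)
        ε′≗ rewrite binVal-setB-getB α₁ 0 | α₁≡h = markedTape-upd h a′ ε≗
        time : ∀ h t → 2 * h + 2 + (2 + t) ≡ 2 * h + 4 + t
        time = solve-∀

    Simulated : TMConf Red → ℕ → ℕ → List Bool → (ℕ → Γ m′) → ℕ → ℕ → Set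
    Simulated c tb ib α′ ε′ t′ io′ = Encodes c α′ ε′ × t′ ≤ tb × io′ ≤ ib

    simulate-halted : ∀ q τ h {μ α ε t io} → TM.halt Red q ≡ true → Encodes (tmconf q τ h) α ε →
      Reaches (cfg (phase simulate q) μ α 0 ε t io) (control seekRead) 0 (Simulated (tmconf q τ h) (suc t) io)
    simulate-halted q τ h {μ} {α} halted (α≡h , ε≗) =
      normal-step (phase simulate q) refl (cong (λ b → (if b then control seekRead else phase fetch q) , μ 0 , getB α 0 , S) halted) ▹
      stay ((trans (binVal-setB-getB α 0) α≡h , ε≗) , ≤-refl , ≤-refl)

    simulate-run : ∀ r c B {μ α ε t io} → Halted (tmRun Red r c) → TMConf.head c + r ≤ B → Encodes c α ε →
      Reaches (cfg (phase simulate (TMConf.state c)) μ α 0 ε t io) (control seekRead) 0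
        (Simulated (tmRun Red r c) (r * (2 * B + 4) + 1 + t) (2 * r + io))
    simulate-run zero (tmconf q τ h) B halted _ enc = simulate-halted q τ h halted enc
    simulate-run (suc r) (tmconf q τ h) B {μ} {α} {ε} {t} {io} halts h+r≤B enc with TM.halt Red q ≟ᵇ true
    ... | yes hq =
      subst (λ c → Reaches (cfg (phase simulate q) μ α 0 ε t io) (control seekRead) 0
                           (Simulated c (suc r * (2 * B + 4) + 1 + t) (2 * suc r + io)))
            (sym (tmRun-halted (suc r) (tmconf q τ h) hq))
            (weaken (λ { (enc′ , t′≤ , io′≤) → enc′ , ≤-trans t′≤ (+-monoˡ-≤ t (m≤n+m 1 _)) , ≤-trans io′≤ (m≤n+m io _) })
                    (simulate-halted q τ h hq enc))
    ... | no ¬hq =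
      subst (λ c → Reaches (cfg (phase simulate q) μ α 0 ε t io) (control seekRead) 0
                           (Simulated (tmRun Red r c) (suc r * X + 1 + t) (2 * suc r + io)))
            (sym (tmStep-running q τ h hq))
            (simulate-step q τ h hq enc >>= λ { (enc′ , t′≤ , refl) →
             weaken (λ { (enc″ , t″≤ , io″≤) → enc″ , time t″≤ t′≤ , ≤-trans io″≤ (≤-reflexive (ios r io)) })
                    (simulate-run r _ B halts′ h′+r≤B enc′) })
      where
        hq : TM.halt Red q ≡ false
        hq = ¬-not ¬hq
        X = 2 * B + 4
        mv = proj₂ (proj₂ (TM.δ Red q (τ h)))
        halts′ : Halted (tmRun Red r (tmconf (proj₁ (TM.δ Red q (τ h))) (upd τ h (proj₁ (proj₂ (TM.δ Red q (τ h))))) (move mv h)))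
        halts′ = subst (λ c → Halted (tmRun Red r c)) (tmStep-running q τ h hq) halts
        h′+r≤B : move mv h + r ≤ B
        h′+r≤B = ≤-trans (+-monoˡ-≤ r (move≤suc mv h)) (≤-trans (≤-reflexive (sym (+-suc h r))) h+r≤B)
        time : ∀ {t′ t″} → t″ ≤ r * X + 1 + t′ → t′ ≤ 2 * h + 4 + t → t″ ≤ suc r * X + 1 + t
        time {t′} {t″} t″≤ t′≤ = begin
          t″                           ≤⟨ t″≤ ⟩
          r * X + 1 + t′               ≤⟨ +-monoʳ-≤ (r * X + 1) t′≤ ⟩
          r * X + 1 + (2 * h + 4 + t)  ≤⟨ +-monoʳ-≤ (r * X + 1) (+-monoˡ-≤ t (+-monoˡ-≤ 4 (*-monoʳ-≤ 2 h≤B))) ⟩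
          r * X + 1 + (X + t)          ≡⟨ shuffle r X t ⟩
          suc r * X + 1 + t            ∎
          where
            open ≤-Reasoning
            h≤B : h ≤ B
            h≤B = ≤-trans (m≤m+n h (suc r)) h+r≤B
            shuffle : ∀ r X t → r * X + 1 + (X + t) ≡ suc r * X + 1 + t
            shuffle = solve-∀
        ios : ∀ r io → 2 * r + (2 + io) ≡ 2 * suc r + io
        ios = solve-∀

    seek-run : ∀ h B τ {μ α ε t io} → h ≤ B → binVal α ≡ h → ε ≗ markedTape τ →
      Reaches (cfg (control seekRead) μ α 0 ε t io) (control done) 0
        (λ α′ ε′ t′ io′ → ε′ ≗ plain ∘ τ × t′ ≤ h * (2 * B + 3) + 1 + t × io′ ≤ h + 2 + io)
    seek-run zero B τ {μ} {α} {ε} _ α≡0 ε≗ =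
      read-step (control seekRead) refl ▹
      normal-step (control seekCheck) refl (cong (λ za → checkOrigin za (ε (binVal α)) (getB α 0)) (checked α α≡0 ε≗)) ▹
      write-step (control unmarkOrigin) refl ▹
      stay (unmarked , ≤-refl , ≤-refl)
      where
        unmarked : upd ε (binVal (setB α 0 (getB α 0))) (plain (τ 0)) ≗ plain ∘ τ
        unmarked i rewrite binVal-setB-getB α 0 | α≡0 with i
        ... | zero  = refl
        ... | suc j = ε≗ (suc j)
    seek-run (suc h) B τ {μ} {α} {ε} {t} {io} 1+h≤B α≡1+h ε≗ =
      read-step (control seekRead) refl ▹
      normal-step (control seekCheck) refl (cong (λ za → checkOrigin za (ε (binVal α)) (getB α 0)) (checked α α≡1+h ε≗)) ▹
      (decrement seek (trans (binVal-setB-getB α 0) α≡1+h) >>= λ { (refl , refl , α′≡h , t′≤) →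
       weaken (λ { (ε″≗ , t″≤ , io″≤) → ε″≗ , time t″≤ t′≤ , ≤-trans io″≤ (≤-reflexive (+-suc (h + 2) io)) })
              (seek-run h B τ h≤B α′≡h ε≗) })
      where
        X = 2 * B + 3
        h≤B : h ≤ B
        h≤B = ≤-trans (n≤1+n h) 1+h≤B
        time : ∀ {t′ t″} → t″ ≤ h * X + 1 + t′ → t′ ≤ 2 * h + 2 + suc t → t″ ≤ suc h * X + 1 + t
        time {t′} {t″} t″≤ t′≤ = begin
          t″                             ≤⟨ t″≤ ⟩
          h * X + 1 + t′                 ≤⟨ +-monoʳ-≤ (h * X + 1) t′≤ ⟩
          h * X + 1 + (2 * h + 2 + suc t) ≤⟨ +-monoʳ-≤ (h * X + 1) (≤-reflexive (shift h t)) ⟩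
          h * X + 1 + (2 * h + 3 + t)    ≤⟨ +-monoʳ-≤ (h * X + 1) (+-monoˡ-≤ t (+-monoˡ-≤ 3 (*-monoʳ-≤ 2 h≤B))) ⟩
          h * X + 1 + (X + t)            ≡⟨ shuffle h X t ⟩
          suc h * X + 1 + t              ∎
          where
            open ≤-Reasoning
            shift : ∀ h t → 2 * h + 2 + suc t ≡ 2 * h + 3 + t
            shift = solve-∀
            shuffle : ∀ h X t → h * X + 1 + (X + t) ≡ suc h * X + 1 + t
            shuffle = solve-∀

    initialise : ∀ w′ w → nth w′ ≗ plain ∘ nth w →
      Reaches (tlmInit simulator w′) (phase simulate q₀) 0 (λ α ε t io → Encodes (tmInit Red w) α ε × t ≡ 1 × io ≡ 2)
    initialise w′ w w′≗ =
      read-step (control readOrigin) refl ▹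
      normal-step (control markOrigin) {α = []} refl refl ▹
      write-step (control writeOrigin) refl ▹
      stay ((refl , marked₀) , refl , refl)
      where
        marked₀ : upd (nth w′) 0 (marked (proj₂ (untag (nth w′ 0)))) ≗ markedTape (nth w)
        marked₀ zero    = cong (marked ∘ proj₂) (trans (cong untag (w′≗ 0)) (untag-tag false (nth w 0)))
        marked₀ (suc i) = w′≗ (suc i)

    simulate-all : ∀ w′ w r → nth w′ ≗ plain ∘ nth w → Halted (tmRun Red r (tmInit Red w)) →
      Reaches (tlmInit simulator w′) (control done) 0
        (λ α ε t io → ε ≗ plain ∘ TMConf.tape (tmRun Red r (tmInit Red w))
                      × t ≤ 5 * (suc r * suc r) × io ≤ 5 * (suc r * suc r))
    simulate-all w′ w r w′≗ halts =
      initialise w′ w w′≗ >>= λ { (enc , refl , refl) →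
      simulate-run r (tmInit Red w) r halts ≤-refl enc >>= λ { ((α≡h , ε≗) , t≤ , io≤) →
      weaken (λ { (ε′≗ , t′≤ , io′≤) → ε′≗ , total-time t′≤ t≤ , total-io io′≤ io≤ })
             (seek-run h r (TMConf.tape final) h≤r α≡h ε≗) } }
      where
        final = tmRun Red r (tmInit Red w)
        h = TMConf.head final
        h≤r : h ≤ r
        h≤r = ≤-trans (tmRun-head≤ r (tmInit Red w)) (≤-reflexive (+-identityʳ r))
        total-time : ∀ {t′ t″} → t″ ≤ h * (2 * r + 3) + 1 + t′ → t′ ≤ r * (2 * r + 4) + 1 + 1 → t″ ≤ 5 * (suc r * suc r)
        total-time {t′} {t″} t″≤ t′≤ = begin
          t″                                                 ≤⟨ t″≤ ⟩
          h * (2 * r + 3) + 1 + t′                           ≤⟨ +-mono-≤ (+-monoˡ-≤ 1 (*-monoˡ-≤ (2 * r + 3) h≤r)) t′≤ ⟩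
          r * (2 * r + 3) + 1 + (r * (2 * r + 4) + 1 + 1)   ≤⟨ m≤m+n _ (r * r + 3 * r + 2) ⟩
          _                                                  ≡⟨ square r ⟩
          5 * (suc r * suc r)                                ∎
          where
            open ≤-Reasoning
            square : ∀ r → r * (2 * r + 3) + 1 + (r * (2 * r + 4) + 1 + 1) + (r * r + 3 * r + 2) ≡ 5 * (suc r * suc r)
            square = solve-∀
        total-io : ∀ {io′ io″} → io″ ≤ h + 2 + io′ → io′ ≤ 2 * r + 2 → io″ ≤ 5 * (suc r * suc r)
        total-io {io′} {io″} io″≤ io′≤ = begin
          io″                            ≤⟨ io″≤ ⟩
          h + 2 + io′                    ≤⟨ +-mono-≤ (+-monoˡ-≤ 2 h≤r) io′≤ ⟩
          r + 2 + (2 * r + 2)            ≤⟨ m≤m+n _ (5 * (r * r) + 7 * r + 1) ⟩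
          _                              ≡⟨ square r ⟩
          5 * (suc r * suc r)            ∎
          where
            open ≤-Reasoning
            square : ∀ r → r + 2 + (2 * r + 2) + (5 * (r * r) + 7 * r + 1) ≡ 5 * (suc r * suc r)
            square = solve-∀

    outcome : ∀ {c st ah P} → Reaches c st ah P →
      Σ ℕ λ s → let C = tlmRun simulator M s c in
        TLMConf.state C ≡ encode st × P (TLMConf.adr C) (TLMConf.ext C) (TLMConf.time C) (TLMConf.io C)
    outcome {st = st} {P = P} (reaches s _ _ _ _ _ run p) =
      s , subst (λ C → TLMConf.state C ≡ encode st × P (TLMConf.adr C) (TLMConf.ext C) (TLMConf.time C) (TLMConf.io C))
                (sym run) (refl , p)

  enc-plain : ∀ x k → enc x k ≡ map plain (enc x k)
  enc-plain []          k = cong (sep ∷_) (sym (map-replicate plain k bit1))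
  enc-plain (false ∷ x) k = cong (bit0 ∷_) (enc-plain x k)
  enc-plain (true  ∷ x) k = cong (bit1 ∷_) (enc-plain x k)

  simulates : ∀ M {w′} w t₀ → w′ ≡ map plain w → Halted (tmRun Red t₀ (tmInit Red w)) → ∀ t v → TMOutputs Red w t v →
    Σ ℕ λ s → let C = tlmRun simulator M s (tlmInit simulator w′) in
      TLM.kind simulator (TLMConf.state C) ≡ accept
      × TLMConf.time C ≤ 5 * (suc t₀ * suc t₀) × TLMConf.io C ≤ 5 * (suc t₀ * suc t₀)
      × HoldsWord (TLMConf.ext C) (map plain v)
  simulates M {w′} w t₀ refl halts₀ t v (halts , output) =
    let s , final , ext≗ , time≤ , io≤ = outcome (simulate-all w′ w t₀ (λ i → nth-map plain w i refl) halts₀)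
    in s , trans (cong (kindOf ∘ decode) final) (cong kindOf (decode-encode (control done))) , time≤ , io≤ ,
       HoldsWord-map plain refl v (λ i → trans (ext≗ i) (cong (λ c → plain (TMConf.tape c i)) (halted-unique _ t₀ t halts₀ halts)))
         output
    where open Execution M

nonZero-+1 : ∀ n → NonZero (n + 1)
nonZero-+1 n = >-nonZero (subst (0 <_) (+-comm 1 n) z<s)

square-bound : ∀ T F c Y d .{{_ : NonZero Y}} → T ≤ F * (c * Y ^ d) →
  5 * (suc T * suc T) ≤ 5 * (suc c * suc c) * (F + 1) ^ (suc d + suc d) * Y ^ (suc d + suc d)
square-bound T F c Y d T≤ = begin
  5 * (suc T * suc T)              ≤⟨ *-monoʳ-≤ 5 (*-mono-≤ 1+T≤ 1+T≤) ⟩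
  5 * (G * (C * P) * (G * (C * P))) ≡⟨ regroup G C P ⟩
  5 * (C * C) * (G * G) * (P * P)   ≡⟨ sym (cong₂ (λ u v → 5 * (C * C) * u * v)
                                          (^-distribˡ-+-* (F + 1) (suc d) (suc d)) (^-distribˡ-+-* Y (suc d) (suc d))) ⟩
  5 * (C * C) * (F + 1) ^ (suc d + suc d) * Y ^ (suc d + suc d) ∎
  where
    open ≤-Reasoning
    C = suc c
    G = (F + 1) ^ suc d
    P = Y ^ suc d
    instance _ = nonZero-+1 F
    instance _ = m^n≢0 (F + 1) d
    instance _ = m^n≢0 Y d
    instance _ = m*n≢0 C (Y ^ d)
    distrib : ∀ F z → z + F * z ≡ (F + 1) * z
    distrib = solve-∀
    1+T≤ : suc T ≤ G * (C * P)
    1+T≤ = begin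
      suc T                           ≤⟨ s≤s T≤ ⟩
      1 + F * (c * Y ^ d)             ≤⟨ +-mono-≤ (>-nonZero⁻¹ (C * Y ^ d)) (*-monoʳ-≤ F (*-monoˡ-≤ (Y ^ d) (n≤1+n c))) ⟩
      C * Y ^ d + F * (C * Y ^ d)     ≡⟨ distrib F (C * Y ^ d) ⟩
      (F + 1) * (C * Y ^ d)           ≤⟨ *-mono-≤ (m≤m*n (F + 1) ((F + 1) ^ d)) (*-monoʳ-≤ C (m≤n*m (Y ^ d) Y)) ⟩
      G * (C * P)                     ∎
    regroup : ∀ G C P → 5 * (G * (C * P) * (G * (C * P))) ≡ 5 * (C * C) * (G * G) * (P * P)
    regroup = solve-∀

lemma3 : {m : ℕ} (A B : List Bool → ℕ → Set) (Red : TM m) (f g : ℕ → ℕ) (c d : ℕ)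
    → ((x : List Bool) (k : ℕ) → Σ ℕ λ t → Σ (List Bool) λ x' → Σ ℕ λ k' →
          (t ≤ f k * (c * (length x + 1) ^ d))
          × TMOutputs Red (enc x k) t (enc x' k')
          × (k' ≤ g k)
          × (A x k ⇔ B x' k'))
    → Σ ℕ λ m' → Σ (TLM m') λ N → Σ ℕ λ a → Σ ℕ λ b →
        (x : List Bool) (k : ℕ) (t : ℕ) (x' : List Bool) (k' : ℕ) →
        TMOutputs Red (enc x k) t (enc x' k') →
        Σ ℕ λ s →
          let C = tlmRun N (suc (a * (g k + 1) ^ b)) s (tlmInit N (enc x k)) in
          (TLM.kind N (TLMConf.state C) ≡ accept)
          × (TLMConf.time C ≤ a * (f k + 1) ^ b * (length x + 1) ^ b)
          × (TLMConf.io C ≤ a * (f k + 1) ^ b * (length x + 1) ^ b)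
          × HoldsWord (TLMConf.ext C) (enc x' k')
lemma3 A B Red f g c d reduction =
  m′ , simulator , 5 * (suc c * suc c) , suc d + suc d , λ x k t x′ k′ output →
    let t₀ , _ , _ , t₀≤ , (halts₀ , _) , _ = reduction x k
        s , accepts , time≤ , io≤ , holds = simulates _ (enc x k) t₀ (enc-plain x k) halts₀ t (enc x′ k′) output
        bound = square-bound t₀ (f k) c (length x + 1) d {{nonZero-+1 (length x)}} t₀≤
    in s , accepts , ≤-trans time≤ bound , ≤-trans io≤ bound , subst (HoldsWord _) (sym (enc-plain x′ k′)) holds
  where open Simulator Red
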